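{- Let $\mathcal{K}_N$ be a complete graph on $N$ totally ordered vertices whose edges are colored red and blue. Then there is a set $U$ of at least $\lfloor N/(16\cdot 10^5)\rfloor$ vertices of $\mathcal{K}_N$ satisfying one of the following: (1) every vertex of $U$ has at least $N/11$ blue neighbors to the left of $U$ and at least $N/11$ blue neighbors to the right of $U$; (2) every vertex of $U$ has at least $N/11$ red neighbors to the left of $U$ and at least $N/11$ red neighbors to the right of $U$.
   Context: A vertex $v$ is to the left (right) of a vertex set $U$ if $v$ precedes (is preceded by) every vertex of $U$ in the ordering. A blue (red) neighbor of $u$ is a vertex joined to $u$ by a blue (red) edge. -}

module Defs where

open import Data.Nat using (ℕ; _*_; _≤_)
open import Data.Fin using (Fin; _<_; _<?_)
open import Data.Fin.Properties using (all?)
open import Data.Fin.Subset using (Subset; _∈_)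
open import Data.Fin.Subset.Properties using (_∈?_)
open import Data.List using (allFin; filter; length)
open import Data.Product using (_×_)
open import Relation.Binary.PropositionalEquality using (_≡_)
open import Relation.Nullary using (Dec; yes; no; _×-dec_; _→-dec_)

data Colour : Set where
  red blue : Colour

_≟ᶜ_ : (a b : Colour) → Dec (a ≡ b)
red ≟ᶜ red = yes _≡_.refl
blue ≟ᶜ blue = yes _≡_.refl
red ≟ᶜ blue = no (λ ())
blue ≟ᶜ red = no (λ ())

-- The colouring is a
-- symmetric function; its value on the diagonal (u,u) is irrelevant.
record Colouring (N : ℕ) : Set where
  field
    col : Fin N → Fin N → Colour
    sym : ∀ u v → col u v ≡ col v u
open Colouring public

LeftOf : ∀ {N} → Subset N → Fin N → Set
LeftOf U v = ∀ w → w ∈ U → v < w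

RightOf : ∀ {N} → Subset N → Fin N → Set
RightOf U v = ∀ w → w ∈ U → w < v

leftOf? : ∀ {N} (U : Subset N) v → Dec (LeftOf U v)
leftOf? U v = all? (λ w → (w ∈? U) →-dec (v <? w))

rightOf? : ∀ {N} (U : Subset N) v → Dec (RightOf U v)
rightOf? U v = all? (λ w → (w ∈? U) →-dec (w <? v))

-- number of vertices v with uv of colour k and v to the left (right) of U.
-- (For u ∈ U, such a v is automatically distinct from u.)
leftNbrs : ∀ {N} → Colouring N → Colour → Subset N → Fin N → ℕ
leftNbrs {N} c k U u =
  length (filter (λ v → (col c u v ≟ᶜ k) ×-dec leftOf? U v) (allFin N))

rightNbrs : ∀ {N} → Colouring N → Colour → Subset N → Fin N → ℕ
rightNbrs {N} c k U u =
  length (filter (λ v → (col c u v ≟ᶜ k) ×-dec rightOf? U v) (allFin N))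

-- every vertex of U has at least N/11 neighbours of colour k to the left of U
-- and at least N/11 to the right of U (real inequality x ≥ N/11 written N ≤ 11 * x)
Good : ∀ {N} → Colouring N → Colour → Subset N → Set
Good {N} c k U =
  ∀ u → u ∈ U → (N ≤ 11 * leftNbrs c k U u) × (N ≤ 11 * rightNbrs c k U u)

module Submission where

open import Defs
open import Data.Nat using (ℕ; _≤_; _/_)
open import Data.Fin.Subset using (Subset; ∣_∣)
open import Data.Product using (Σ; _×_)
open import Data.Sum using (_⊎_)

open import Data.Nat
open import Data.Nat.Properties
open import Data.Nat.DivMod using (_%_; m≡m%n+[m/n]*n; m%n<n; m/n*n≤m; m<n⇒m/n≡0)
open import Data.Nat.Tactic.RingSolver using (solve-∀)
open import Data.Product using (_,_; proj₁; proj₂; ∃)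
open import Data.Sum using (inj₁; inj₂; map)
open import Data.Empty using (⊥-elim)
open import Data.Unit using (tt)
open import Data.Bool using (true)
open import Data.Fin using (Fin; toℕ; fromℕ<)
import Data.Fin as Fin
open import Data.Fin.Properties using (toℕ<n; fromℕ<-toℕ)
open import Data.Fin.Subset using (_∈_) renaming (⊥ to ∅)
open import Data.Fin.Subset.Properties using (∉⊥)
open import Data.Vec using (tabulate)
open import Data.Vec.Properties using (lookup∘tabulate; []=⇒lookup)
import Data.List as List
open import Function using (_∘_)
open import Relation.Nullary using (Dec; does; yes; no; ¬_; _×-dec_)
open import Relation.Binary.PropositionalEquality renaming (sym to ≡-sym)

-- Identify the vertices with the numbers below N and write L k u
-- (R k u) for the number of colour-k edges from u to vertices before (after) u.
-- Put d = ⌊N/11⌋, s = ⌊N/1000⌋ + 1 and pick a threshold a = 12(t+1) > d + s.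
-- Call u k-rich if L k u ≥ a and R k u ≥ a, and k-skewed if R k u < a and
-- L (other k) u < a.
--   * Every vertex at distance ≥ 2a from both ends is rich or skewed for some
--     colour (Thresholds.classify).
--   * A set of m k-skewed vertices is small: each of its pairs is a k-edge seen
--     from its earlier endpoint or an other-colour edge seen from its later
--     endpoint, so C(m,2) ≤ 2·Σ_{i<m} min(i, a-1), which forces m < 41(t+1)
--     (Degrees.skewed-small).
--   * Hence at least 2000·⌊N/(16·10^5)⌋ vertices are rich, at least half of them
--     for one colour k.  Cutting [0, 1000s) into 1000 blocks of length s, some
--     block contains q = ⌊N/(16·10^5)⌋ k-rich vertices; they form U
--     (RichBlock).  A vertex of U has ≥ a colour-k neighbours on each side, fewer
--     than s of them inside the block, so more than d = ⌊N/11⌋, hence at least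
--     N/11, of them beyond U.
-- The file develops finite sums and indicators, the pair-counting bound for 0/1
-- sequences, degree bookkeeping for a colouring, the classification, the block
-- construction and the constants, and ends with lemma3.

∑ : ℕ → (ℕ → ℕ) → ℕ
∑ zero    g = 0
∑ (suc n) g = ∑ n g + g n

syntax ∑ n (λ i → e) = ∑[ i < n ] e

∑-cong : ∀ n {g h : ℕ → ℕ} → (∀ i → i < n → g i ≡ h i) → ∑ n g ≡ ∑ n h
∑-cong zero    e = refl
∑-cong (suc n) e = cong₂ _+_ (∑-cong n (λ i i<n → e i (m<n⇒m<1+n i<n))) (e n ≤-refl)

∑-mono : ∀ n {g h : ℕ → ℕ} → (∀ i → i < n → g i ≤ h i) → ∑ n g ≤ ∑ n h
∑-mono zero    e = z≤n
∑-mono (suc n) e = +-mono-≤ (∑-mono n (λ i i<n → e i (m<n⇒m<1+n i<n))) (e n ≤-refl)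

∑-+ : ∀ n (g h : ℕ → ℕ) → ∑[ i < n ] (g i + h i) ≡ ∑ n g + ∑ n h
∑-+ zero    g h = refl
∑-+ (suc n) g h rewrite ∑-+ n g h = interchange (∑ n g) (∑ n h) (g n) (h n)
  where
  interchange : ∀ a b x y → a + b + (x + y) ≡ a + x + (b + y)
  interchange = solve-∀

∑-*ˡ : ∀ n k (g : ℕ → ℕ) → ∑[ i < n ] (k * g i) ≡ k * ∑ n g
∑-*ˡ zero    k g = ≡-sym (*-zeroʳ k)
∑-*ˡ (suc n) k g rewrite ∑-*ˡ n k g = ≡-sym (*-distribˡ-+ k (∑ n g) (g n))

∑-const : ∀ n k → ∑[ i < n ] k ≡ n * k
∑-const zero    k = refl
∑-const (suc n) k rewrite ∑-const n k = +-comm (n * k) k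

∑-zero : ∀ n {g : ℕ → ℕ} → (∀ i → i < n → g i ≡ 0) → ∑ n g ≡ 0
∑-zero n e = trans (∑-cong n e) (trans (∑-const n 0) (*-zeroʳ n))

∑-++ : ∀ m n (g : ℕ → ℕ) → ∑ (m + n) g ≡ ∑ m g + ∑[ i < n ] g (m + i)
∑-++ m zero    g rewrite +-identityʳ m = ≡-sym (+-identityʳ _)
∑-++ m (suc n) g rewrite +-suc m n | ∑-++ m n g = +-assoc (∑ m g) _ _

-- Peeling off the first term, the form needed for induction over Fin n.
∑-suc : ∀ n (g : ℕ → ℕ) → ∑ (suc n) g ≡ g 0 + ∑[ i < n ] g (suc i)
∑-suc zero    g = ≡-sym (+-identityʳ _)
∑-suc (suc n) g rewrite ∑-suc n g = +-assoc (g 0) _ _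

∑-≤-length : ∀ n {g : ℕ → ℕ} → (∀ i → i < n → g i ≤ 1) → ∑ n g ≤ n
∑-≤-length n e = ≤-trans (∑-mono n e) (≤-reflexive (trans (∑-const n 1) (*-identityʳ n)))

∑-monoˡ : ∀ {m n} (g : ℕ → ℕ) → m ≤ n → ∑ m g ≤ ∑ n g
∑-monoˡ {m} {n} g m≤n = begin
  ∑ m g                              ≤⟨ m≤m+n _ _ ⟩
  ∑ m g + ∑[ i < n ∸ m ] g (m + i)   ≡⟨ ≡-sym (∑-++ m (n ∸ m) g) ⟩
  ∑ (m + (n ∸ m)) g                  ≡⟨ cong (λ z → ∑ z g) (m+[n∸m]≡n m≤n) ⟩
  ∑ n g                              ∎
  where open ≤-Reasoning

∑-support : ∀ m n (g : ℕ → ℕ) → (∀ i → n ≤ i → g i ≡ 0) → ∑ m g ≤ ∑ n g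
∑-support m n g vanish with m ≤? n
... | yes m≤n = ∑-monoˡ g m≤n
... | no  m≰n = ≤-reflexive (begin
  ∑ m g                              ≡⟨ cong (λ z → ∑ z g) (≡-sym (m+[n∸m]≡n (≰⇒≥ m≰n))) ⟩
  ∑ (n + (m ∸ n)) g                  ≡⟨ ∑-++ n (m ∸ n) g ⟩
  ∑ n g + ∑[ i < m ∸ n ] g (n + i)   ≡⟨ cong (∑ n g +_) (∑-zero (m ∸ n) (λ i _ → vanish (n + i) (m≤m+n n i))) ⟩
  ∑ n g + 0                          ≡⟨ +-identityʳ _ ⟩
  ∑ n g                              ∎)
  where open ≡-Reasoning

∑-blocks : ∀ s J (g : ℕ → ℕ) → ∑ (s * J) g ≡ ∑[ j < J ] ∑[ i < s ] g (s * j + i)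
∑-blocks s zero    g rewrite *-zeroʳ s = refl
∑-blocks s (suc J) g = begin
  ∑ (s * suc J) g                              ≡⟨ cong (λ z → ∑ z g) (trans (*-suc s J) (+-comm s (s * J))) ⟩
  ∑ (s * J + s) g                              ≡⟨ ∑-++ (s * J) s g ⟩
  ∑ (s * J) g + ∑[ i < s ] g (s * J + i)       ≡⟨ cong (_+ ∑[ i < s ] g (s * J + i)) (∑-blocks s J g) ⟩
  ∑[ j < suc J ] ∑[ i < s ] g (s * j + i)      ∎
  where open ≡-Reasoning

pigeonhole : ∀ J q (b : ℕ → ℕ) → suc J * q ≤ ∑ (suc J) b → ∃ λ j → q ≤ b j
pigeonhole zero    q b total = 0 , ≤-trans (≤-reflexive (≡-sym (+-identityʳ q))) total
pigeonhole (suc J) q b total with q ≤? b (suc J)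
... | yes q≤b = suc J , q≤b
... | no  q≰b = pigeonhole J q b (+-cancelʳ-≤ q _ _ (begin
  suc J * q + q                  ≡⟨ +-comm (suc J * q) q ⟩
  suc (suc J) * q                ≤⟨ total ⟩
  ∑ (suc J) b + b (suc J)        ≤⟨ +-monoʳ-≤ (∑ (suc J) b) (<⇒≤ (≰⇒> q≰b)) ⟩
  ∑ (suc J) b + q                ∎))
  where open ≤-Reasoning

𝟙 : {P : Set} → Dec P → ℕ
𝟙 (yes _) = 1
𝟙 (no _)  = 0

𝟙≤1 : {P : Set} (p? : Dec P) → 𝟙 p? ≤ 1
𝟙≤1 (yes _) = ≤-refl
𝟙≤1 (no _)  = z≤n

𝟙-yes : {P : Set} (p? : Dec P) → P → 𝟙 p? ≡ 1
𝟙-yes (yes _) _ = refl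
𝟙-yes (no ¬p) p = ⊥-elim (¬p p)

𝟙-pos : {P : Set} (p? : Dec P) → P → 1 ≤ 𝟙 p?
𝟙-pos p? p = ≤-reflexive (≡-sym (𝟙-yes p? p))

𝟙-no : {P : Set} (p? : Dec P) → ¬ P → 𝟙 p? ≡ 0
𝟙-no (yes p) ¬p = ⊥-elim (¬p p)
𝟙-no (no _)  _  = refl

𝟙⇒ : {P : Set} (p? : Dec P) → 𝟙 p? ≡ 1 → P
𝟙⇒ (yes p) _ = p

𝟙-mono : {P Q : Set} (p? : Dec P) (q? : Dec Q) → (P → Q) → 𝟙 p? ≤ 𝟙 q?
𝟙-mono (yes p) q? p⇒q = ≤-reflexive (≡-sym (𝟙-yes q? (p⇒q p)))
𝟙-mono (no _)  q? p⇒q = z≤n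

𝟙-cong : {P Q : Set} (p? : Dec P) (q? : Dec Q) → (P → Q) → (Q → P) → 𝟙 p? ≡ 𝟙 q?
𝟙-cong p? q? p⇒q q⇒p = ≤-antisym (𝟙-mono p? q? p⇒q) (𝟙-mono q? p? q⇒p)

𝟙-× : {P Q : Set} (p? : Dec P) (q? : Dec Q) → 𝟙 (p? ×-dec q?) ≡ 𝟙 p? * 𝟙 q?
𝟙-× (yes _) (yes _) = refl
𝟙-× (yes _) (no _)  = refl
𝟙-× (no _)  q?      = refl

𝟙-<-suc : ∀ i j → 𝟙 (suc i <? suc j) ≡ 𝟙 (i <? j)
𝟙-<-suc i j = 𝟙-cong (suc i <? suc j) (i <? j) s<s⁻¹ s<s

∑-after : ∀ n u → ∑[ v < n ] 𝟙 (u <? v) ≡ n ∸ suc u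
∑-after zero    u = refl
∑-after (suc n) u with u <? n
... | yes u<n rewrite ∑-after n u = trans (+-comm (n ∸ suc u) 1) (≡-sym (+-∸-assoc 1 u<n))
... | no  u≮n rewrite ∑-after n u =
  trans (+-identityʳ _) (trans (m≤n⇒m∸n≡0 (m≤n⇒m≤1+n (≮⇒≥ u≮n))) (≡-sym (m≤n⇒m∸n≡0 (≮⇒≥ u≮n))))

∑-prefix : ∀ {p n} (h : ℕ → ℕ) → p ≤ n → ∑[ i < n ] (𝟙 (i <? p) * h i) ≡ ∑ p h
∑-prefix {p} {n} h p≤n = begin
  ∑[ i < n ] (𝟙 (i <? p) * h i)                                    ≡⟨ cong (λ z → ∑[ i < z ] (𝟙 (i <? p) * h i)) (≡-sym (m+[n∸m]≡n p≤n)) ⟩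
  ∑[ i < p + (n ∸ p) ] (𝟙 (i <? p) * h i)                          ≡⟨ ∑-++ p (n ∸ p) _ ⟩
  ∑[ i < p ] (𝟙 (i <? p) * h i) + ∑[ i < n ∸ p ] (𝟙 (p + i <? p) * h (p + i))
     ≡⟨ cong₂ _+_ (∑-cong p (λ i i<p → trans (cong (_* h i) (𝟙-yes (i <? p) i<p)) (+-identityʳ (h i))))
                  (∑-zero (n ∸ p) (λ i _ → cong (_* h (p + i)) (𝟙-no (p + i <? p) (≤⇒≯ (m≤m+n p i))))) ⟩
  ∑ p h + 0                                                        ≡⟨ +-identityʳ _ ⟩
  ∑ p h                                                            ∎
  where open ≡-Reasoning

∑-triangle : ∀ n (g : ℕ → ℕ → ℕ) →
  ∑[ j < n ] ∑[ i < j ] g i j ≡ ∑[ i < n ] ∑[ j < n ] (𝟙 (i <? j) * g i j)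
∑-triangle zero    g = refl
∑-triangle (suc n) g = begin
  ∑[ j < n ] ∑[ i < j ] g i j + ∑[ i < n ] g i n
    ≡⟨ cong (_+ ∑[ i < n ] g i n) (∑-triangle n g) ⟩
  ∑[ i < n ] ∑[ j < n ] (𝟙 (i <? j) * g i j) + ∑[ i < n ] g i n
    ≡⟨ ≡-sym (∑-+ n _ _) ⟩
  ∑[ i < n ] (∑[ j < n ] (𝟙 (i <? j) * g i j) + g i n)
    ≡⟨ ∑-cong n (λ i i<n → cong (∑[ j < n ] (𝟙 (i <? j) * g i j) +_)
         (≡-sym (trans (cong (_* g i n) (𝟙-yes (i <? n) i<n)) (+-identityʳ _)))) ⟩
  ∑[ i < n ] ∑[ j < suc n ] (𝟙 (i <? j) * g i j)
    ≡⟨ ≡-sym (+-identityʳ _) ⟩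
  ∑[ i < n ] ∑[ j < suc n ] (𝟙 (i <? j) * g i j) + 0
    ≡⟨ cong (∑[ i < n ] ∑[ j < suc n ] (𝟙 (i <? j) * g i j) +_)
         (≡-sym (∑-zero (suc n) (λ j j<1+n → cong (_* g n j) (𝟙-no (n <? j) (≤⇒≯ (≤-pred j<1+n)))))) ⟩
  ∑[ i < suc n ] ∑[ j < suc n ] (𝟙 (i <? j) * g i j)
    ∎
  where open ≡-Reasoning

-- X is a 0/1 sequence, i.e. the indicator of a set of numbers; ∑ n X is then
-- the size of that set below n.
Bin : (ℕ → ℕ) → Set
Bin X = ∀ i → X i ≤ 1

bin-cases : ∀ x → x ≤ 1 → x ≡ 0 ⊎ x ≡ 1
bin-cases zero          _         = inj₁ refl
bin-cases (suc zero)    _         = inj₂ refl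
bin-cases (suc (suc x)) (s≤s ())

-- pairs m = C(m, 2) is the number of pairs in an m-set; capped m c bounds the
-- number of those pairs when each element may be charged for at most c of them.
pairs : ℕ → ℕ
pairs m = ∑[ i < m ] i

capped : ℕ → ℕ → ℕ
capped m c = ∑[ i < m ] (i ⊓ c)

-- Counting the pairs of a set by their larger element.
pairs-by-rank : ∀ n (X : ℕ → ℕ) → Bin X → ∑[ j < n ] (X j * ∑ j X) ≡ pairs (∑ n X)
pairs-by-rank zero    X bX = refl
pairs-by-rank (suc n) X bX with bin-cases (X n) (bX n)
... | inj₁ Xn≡0 rewrite Xn≡0 | +-identityʳ (∑ n X) = trans (+-identityʳ _) (pairs-by-rank n X bX)
... | inj₂ Xn≡1 rewrite Xn≡1 | +-comm (∑ n X) 1 | +-identityʳ (∑ n X) =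
  cong (_+ ∑ n X) (pairs-by-rank n X bX)

capped-backward : ∀ c n (X B : ℕ → ℕ) → Bin X →
  (∀ j → j < n → X j ≡ 1 → B j ≤ c) → (∀ j → j < n → B j ≤ ∑ j X) →
  ∑[ j < n ] (X j * B j) ≤ capped (∑ n X) c
capped-backward c zero    X B bX B≤c B≤earlier = z≤n
capped-backward c (suc n) X B bX B≤c B≤earlier = step (bin-cases (X n) (bX n))
  where
  ih : ∑[ j < n ] (X j * B j) ≤ capped (∑ n X) c
  ih = capped-backward c n X B bX (λ j j<n → B≤c j (m<n⇒m<1+n j<n)) (λ j j<n → B≤earlier j (m<n⇒m<1+n j<n))
  step : X n ≡ 0 ⊎ X n ≡ 1 → ∑[ j < n ] (X j * B j) + X n * B n ≤ capped (∑ n X + X n) c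
  step (inj₁ Xn≡0) rewrite Xn≡0 | +-identityʳ (∑ n X) = ≤-trans (≤-reflexive (+-identityʳ _)) ih
  step (inj₂ Xn≡1) rewrite Xn≡1 | +-comm (∑ n X) 1 | +-identityʳ (B n) =
    +-mono-≤ ih (⊓-glb (B≤earlier n ≤-refl) (B≤c n ≤-refl Xn≡1))

capped-forward : ∀ c n (X F : ℕ → ℕ) → Bin X →
  (∀ i → i < n → X i ≡ 1 → F i ≤ c) → (∀ i → i < n → F i ≤ ∑[ j < n ] (𝟙 (i <? j) * X j)) →
  ∑[ i < n ] (X i * F i) ≤ capped (∑ n X) c
capped-forward c zero    X F bX F≤c F≤later = z≤n
capped-forward c (suc n) X F bX F≤c F≤later
  rewrite ∑-suc n (λ i → X i * F i) | ∑-suc n X = step (bin-cases (X 0) (bX 0))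
  where
  ih : ∑[ i < n ] (X (suc i) * F (suc i)) ≤ capped (∑[ i < n ] X (suc i)) c
  ih = capped-forward c n (λ i → X (suc i)) (λ i → F (suc i)) (λ i → bX (suc i))
         (λ i i<n → F≤c (suc i) (s≤s i<n))
         (λ i i<n → ≤-trans (F≤later (suc i) (s≤s i<n)) (≤-reflexive (trans (∑-suc n _)
           (∑-cong n (λ j _ → cong (_* X (suc j)) (𝟙-<-suc i j))))))
  F0≤later : F 0 ≤ ∑[ i < n ] X (suc i)
  F0≤later = ≤-trans (F≤later 0 (s≤s z≤n))
    (≤-reflexive (trans (∑-suc n _) (∑-cong n (λ i _ → +-identityʳ _))))
  step : X 0 ≡ 0 ⊎ X 0 ≡ 1 →
    X 0 * F 0 + ∑[ i < n ] (X (suc i) * F (suc i)) ≤ capped (X 0 + ∑[ i < n ] X (suc i)) c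
  step (inj₁ X0≡0) rewrite X0≡0 = ih
  step (inj₂ X0≡1) rewrite X0≡1 | +-identityʳ (F 0) =
    ≤-trans (≤-reflexive (+-comm (F 0) _)) (+-mono-≤ ih (⊓-glb F0≤later (F≤c 0 (s≤s z≤n) X0≡1)))

pairs-closed : ∀ m → 2 * pairs m + m ≡ m * m
pairs-closed zero    = refl
pairs-closed (suc m) = begin
  2 * (pairs m + m) + suc m        ≡⟨ regroup (pairs m) m ⟩
  (2 * pairs m + m) + (2 * m + 1)  ≡⟨ cong (_+ (2 * m + 1)) (pairs-closed m) ⟩
  m * m + (2 * m + 1)              ≡⟨ square m ⟩
  suc m * suc m                    ∎
  where
  open ≡-Reasoning
  regroup : ∀ p m → 2 * (p + m) + suc m ≡ (2 * p + m) + (2 * m + 1)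
  regroup = solve-∀
  square : ∀ m → m * m + (2 * m + 1) ≡ suc m * suc m
  square = solve-∀

capped-high : ∀ c k → capped (c + k) c ≡ pairs c + k * c
capped-high c k = begin
  capped (c + k) c                              ≡⟨ ∑-++ c k _ ⟩
  capped c c + ∑[ i < k ] ((c + i) ⊓ c)         ≡⟨ cong₂ _+_ (∑-cong c (λ i i<c → m≤n⇒m⊓n≡m (<⇒≤ i<c)))
                                                             (∑-cong k (λ i _ → m≥n⇒m⊓n≡n (m≤m+n c i))) ⟩
  pairs c + ∑[ i < k ] c                        ≡⟨ cong (pairs c +_) (∑-const k c) ⟩
  pairs c + k * c                               ∎
  where open ≡-Reasoning

-- The quadratic inequality behind skewed-small, for m = c + k with
-- c = 11 + 12t and k ≥ 30 + 29t: 4·capped m c + m + 2c = 2c² + 4kc + m, which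
-- falls short of m² + 2c by a positive polynomial in t and the excess e.
capped-below-pairs : ∀ t e →
  2 * capped (11 + 12 * t + (30 + 29 * t + e)) (11 + 12 * t) < pairs (11 + 12 * t + (30 + 29 * t + e))
capped-below-pairs t e =
  *-cancelˡ-< 2 (2 * capped m c) (pairs m) (+-cancelʳ-< m _ _ (+-cancelʳ-< (2 * c) _ _ (begin-strict
    2 * (2 * capped m c) + m + 2 * c              ≡⟨ cong (λ z → 2 * (2 * z) + m + 2 * c) (capped-high c k) ⟩
    2 * (2 * (pairs c + k * c)) + m + 2 * c       ≡⟨ regroup (pairs c) (k * c) m c ⟩
    2 * (2 * pairs c + c) + 4 * (k * c) + m       ≡⟨ cong (λ z → 2 * z + 4 * (k * c) + m) (pairs-closed c) ⟩
    2 * (c * c) + 4 * (k * c) + m                 <⟨ m<m+n _ (s≤s z≤n) ⟩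
    2 * (c * c) + 4 * (k * c) + m + surplus       ≡⟨ ≡-sym (expand t e) ⟩
    m * m + 2 * c                                 ≡⟨ cong (_+ 2 * c) (≡-sym (pairs-closed m)) ⟩
    2 * pairs m + m + 2 * c                       ∎)))
  where
  open ≤-Reasoning
  c k m surplus : ℕ
  c = 11 + 12 * t
  k = 30 + 29 * t + e
  m = c + k
  surplus = suc t * suc t + 99 * suc t + 34 * suc t * e + e * e + 3 * e
  regroup : ∀ p q m c → 2 * (2 * (p + q)) + m + 2 * c ≡ 2 * (2 * p + c) + 4 * q + m
  regroup = solve-∀
  expand : ∀ t e → (11 + 12 * t + (30 + 29 * t + e)) * (11 + 12 * t + (30 + 29 * t + e)) + 2 * (11 + 12 * t)
    ≡ 2 * ((11 + 12 * t) * (11 + 12 * t)) + 4 * ((30 + 29 * t + e) * (11 + 12 * t))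
      + (11 + 12 * t + (30 + 29 * t + e))
      + (suc t * suc t + 99 * suc t + 34 * suc t * e + e * e + 3 * e)
  expand = solve-∀

capped-too-small : ∀ t m → 41 * suc t ≤ m → 2 * capped m (11 + 12 * t) < pairs m
capped-too-small t m big =
  subst (λ z → 2 * capped z (11 + 12 * t) < pairs z) m≡ (capped-below-pairs t (m ∸ 41 * suc t))
  where
  split41 : ∀ e t → 11 + 12 * t + (30 + 29 * t + e) ≡ e + 41 * suc t
  split41 = solve-∀
  m≡ : 11 + 12 * t + (30 + 29 * t + (m ∸ 41 * suc t)) ≡ m
  m≡ = trans (split41 (m ∸ 41 * suc t) t) (m∸n+n≡m big)

other : Colour → Colour
other red  = blue
other blue = red

𝟙-colour-or-other : ∀ k x → 𝟙 (x ≟ᶜ k) + 𝟙 (x ≟ᶜ other k) ≡ 1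
𝟙-colour-or-other red  red  = refl
𝟙-colour-or-other red  blue = refl
𝟙-colour-or-other blue red  = refl
𝟙-colour-or-other blue blue = refl

module Degrees {N : ℕ} (c : Colouring N) where

  -- The colouring extended to all of ℕ × ℕ (arbitrarily red outside [0, N)).
  colourOn : ∀ {i j} → Dec (i < N) → Dec (j < N) → Colour
  colourOn (yes i<N) (yes j<N) = col c (fromℕ< i<N) (fromℕ< j<N)
  colourOn _         _         = red

  colour : ℕ → ℕ → Colour
  colour i j = colourOn (i <? N) (j <? N)

  colour-sym : ∀ i j → colour i j ≡ colour j i
  colour-sym i j = symOn (i <? N) (j <? N)
    where
    symOn : ∀ {i j} (i? : Dec (i < N)) (j? : Dec (j < N)) → colourOn i? j? ≡ colourOn j? i?
    symOn (yes _) (yes _) = Colouring.sym c _ _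
    symOn (yes _) (no _)  = refl
    symOn (no _)  (yes _) = refl
    symOn (no _)  (no _)  = refl

  colour-toℕ : ∀ (u v : Fin N) → colour (toℕ u) (toℕ v) ≡ col c u v
  colour-toℕ u v with toℕ u <? N | toℕ v <? N
  ... | yes u<N | yes v<N rewrite fromℕ<-toℕ u u<N | fromℕ<-toℕ v v<N = refl
  ... | no u≮N  | _       = ⊥-elim (u≮N (toℕ<n u))
  ... | yes _   | no v≮N  = ⊥-elim (v≮N (toℕ<n v))

  has : Colour → ℕ → ℕ → ℕ
  has k u v = 𝟙 (colour u v ≟ᶜ k)

  has≤1 : ∀ k u v → has k u v ≤ 1
  has≤1 k u v = 𝟙≤1 (colour u v ≟ᶜ k)

  has-sym : ∀ k u v → has k u v ≡ has k v u
  has-sym k u v = cong (λ x → 𝟙 (x ≟ᶜ k)) (colour-sym u v)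

  L : Colour → ℕ → ℕ
  L k u = ∑[ v < u ] has k u v

  R : Colour → ℕ → ℕ
  R k u = ∑[ v < N ] (𝟙 (u <? v) * has k u v)

  L-total : ∀ k u → L k u + L (other k) u ≡ u
  L-total k u = begin
    L k u + L (other k) u                      ≡⟨ ≡-sym (∑-+ u _ _) ⟩
    ∑[ v < u ] (has k u v + has (other k) u v) ≡⟨ ∑-cong u (λ v _ → 𝟙-colour-or-other k (colour u v)) ⟩
    ∑[ v < u ] 1                               ≡⟨ trans (∑-const u 1) (*-identityʳ u) ⟩
    u                                          ∎
    where open ≡-Reasoning

  R-total : ∀ k u → R k u + R (other k) u ≡ N ∸ suc u
  R-total k u = begin
    R k u + R (other k) u                                          ≡⟨ ≡-sym (∑-+ N _ _) ⟩
    ∑[ v < N ] (𝟙 (u <? v) * has k u v + 𝟙 (u <? v) * has (other k) u v)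
      ≡⟨ ∑-cong N (λ v _ → trans (≡-sym (*-distribˡ-+ (𝟙 (u <? v)) _ _))
           (trans (cong (𝟙 (u <? v) *_) (𝟙-colour-or-other k (colour u v))) (*-identityʳ _))) ⟩
    ∑[ v < N ] 𝟙 (u <? v)                                          ≡⟨ ∑-after N u ⟩
    N ∸ suc u                                                      ∎
    where open ≡-Reasoning

  L-before : ∀ k u p → p ≤ u → L k u ≤ ∑[ v < p ] has k u v + (u ∸ p)
  L-before k u p p≤u = begin
    L k u                                                  ≡⟨ cong (λ z → ∑[ v < z ] has k u v) (≡-sym (m+[n∸m]≡n p≤u)) ⟩
    ∑[ v < p + (u ∸ p) ] has k u v                         ≡⟨ ∑-++ p (u ∸ p) _ ⟩
    ∑[ v < p ] has k u v + ∑[ i < u ∸ p ] has k u (p + i)  ≤⟨ +-monoʳ-≤ _ (∑-≤-length (u ∸ p) (λ i _ → has≤1 k u (p + i))) ⟩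
    ∑[ v < p ] has k u v + (u ∸ p)                         ∎
    where open ≤-Reasoning

  R-after : ∀ k u e → R k u ≤ ∑[ v < N ] (𝟙 (e ≤? v) * has k u v) + (e ∸ suc u)
  R-after k u e = begin
    R k u                                                                ≤⟨ ∑-mono N (λ v _ → split v) ⟩
    ∑[ v < N ] (𝟙 (e ≤? v) * has k u v + 𝟙 (u <? v) * 𝟙 (v <? e))      ≡⟨ ∑-+ N _ _ ⟩
    ∑[ v < N ] (𝟙 (e ≤? v) * has k u v) + ∑[ v < N ] (𝟙 (u <? v) * 𝟙 (v <? e))
                                                                         ≤⟨ +-monoʳ-≤ _ between ⟩
    ∑[ v < N ] (𝟙 (e ≤? v) * has k u v) + (e ∸ suc u)                   ∎
    where
    open ≤-Reasoning
    split : ∀ v → 𝟙 (u <? v) * has k u v ≤ 𝟙 (e ≤? v) * has k u v + 𝟙 (u <? v) * 𝟙 (v <? e)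
    split v with e ≤? v
    ... | yes _   = ≤-trans (*-monoˡ-≤ (has k u v) (𝟙≤1 (u <? v))) (m≤m+n _ _)
    ... | no  e≰v = ≤-trans (*-monoʳ-≤ (𝟙 (u <? v)) (has≤1 k u v))
                            (≤-reflexive (cong (𝟙 (u <? v) *_) (≡-sym (𝟙-yes (v <? e) (≰⇒> e≰v)))))
    between : ∑[ v < N ] (𝟙 (u <? v) * 𝟙 (v <? e)) ≤ e ∸ suc u
    between = begin
      ∑[ v < N ] (𝟙 (u <? v) * 𝟙 (v <? e))
        ≤⟨ ∑-support N e _ (λ v e≤v → trans (cong (𝟙 (u <? v) *_) (𝟙-no (v <? e) (≤⇒≯ e≤v))) (*-zeroʳ (𝟙 (u <? v)))) ⟩
      ∑[ v < e ] (𝟙 (u <? v) * 𝟙 (v <? e))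
        ≤⟨ ∑-mono e (λ v _ → ≤-trans (*-monoʳ-≤ (𝟙 (u <? v)) (𝟙≤1 (v <? e))) (≤-reflexive (*-identityʳ _))) ⟩
      ∑[ v < e ] 𝟙 (u <? v)
        ≡⟨ ∑-after e u ⟩
      e ∸ suc u
        ∎

  inner : Colour → (ℕ → ℕ) → ℕ
  inner k X = ∑[ j < N ] (X j * ∑[ i < j ] (X i * has k i j))

  pairs-split : ∀ k (X : ℕ → ℕ) → Bin X → pairs (∑ N X) ≡ inner k X + inner (other k) X
  pairs-split k X bX = begin
    pairs (∑ N X)                                        ≡⟨ ≡-sym (pairs-by-rank N X bX) ⟩
    ∑[ j < N ] (X j * ∑ j X)                             ≡⟨ ∑-cong N (λ j _ → cong (X j *_) (∑-cong j (λ i _ → split i j))) ⟩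
    ∑[ j < N ] (X j * ∑[ i < j ] (X i * has k i j + X i * has (other k) i j))
      ≡⟨ ∑-cong N (λ j _ → trans (cong (X j *_) (∑-+ j _ _)) (*-distribˡ-+ (X j) _ _)) ⟩
    ∑[ j < N ] (X j * ∑[ i < j ] (X i * has k i j) + X j * ∑[ i < j ] (X i * has (other k) i j))
      ≡⟨ ∑-+ N _ _ ⟩
    inner k X + inner (other k) X                        ∎
    where
    open ≡-Reasoning
    split : ∀ i j → X i ≡ X i * has k i j + X i * has (other k) i j
    split i j = trans (≡-sym (*-identityʳ (X i)))
      (trans (cong (X i *_) (≡-sym (𝟙-colour-or-other k (colour i j)))) (*-distribˡ-+ (X i) _ _))

  -- Charging each colour-k edge of X to its later endpoint: bounded by the left degrees.
  inner-backward : ∀ k cap (X : ℕ → ℕ) → Bin X → (∀ j → j < N → X j ≡ 1 → L k j ≤ cap) →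
    inner k X ≤ capped (∑ N X) cap
  inner-backward k cap X bX L≤cap = capped-backward cap N X _ bX
    (λ j j<N Xj≡1 → ≤-trans (earlier≤L j) (L≤cap j j<N Xj≡1))
    (λ j _ → ∑-mono j (λ i _ → ≤-trans (*-monoʳ-≤ (X i) (has≤1 k i j)) (≤-reflexive (*-identityʳ _))))
    where
    earlier≤L : ∀ j → ∑[ i < j ] (X i * has k i j) ≤ L k j
    earlier≤L j = ∑-mono j (λ i _ → ≤-trans (*-monoˡ-≤ (has k i j) (bX i))
      (≤-reflexive (trans (+-identityʳ _) (has-sym k i j))))

  -- Charging each colour-k edge of X to its earlier endpoint: bounded by the right degrees.
  inner-forward : ∀ k cap (X : ℕ → ℕ) → Bin X → (∀ i → i < N → X i ≡ 1 → R k i ≤ cap) →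
    inner k X ≤ capped (∑ N X) cap
  inner-forward k cap X bX R≤cap = begin
    inner k X                                 ≡⟨ by-earlier-endpoint ⟩
    ∑[ i < N ] (X i * later i)                ≤⟨ capped-forward cap N X later bX
                                                    (λ i i<N Xi≡1 → ≤-trans (later≤R i) (R≤cap i i<N Xi≡1))
                                                    (λ i _ → ∑-mono N (λ j _ → *-monoʳ-≤ (𝟙 (i <? j))
                                                       (≤-trans (*-monoʳ-≤ (X j) (has≤1 k i j)) (≤-reflexive (*-identityʳ _))))) ⟩
    capped (∑ N X) cap                        ∎
    where
    open ≤-Reasoning
    later : ℕ → ℕ
    later i = ∑[ j < N ] (𝟙 (i <? j) * (X j * has k i j))
    later≤R : ∀ i → later i ≤ R k i
    later≤R i = ∑-mono N (λ j _ → *-monoʳ-≤ (𝟙 (i <? j))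
      (≤-trans (*-monoˡ-≤ (has k i j) (bX j)) (≤-reflexive (+-identityʳ _))))
    by-earlier-endpoint : inner k X ≡ ∑[ i < N ] (X i * later i)
    by-earlier-endpoint =
      trans (∑-cong N (λ j _ → ≡-sym (∑-*ˡ j (X j) _)))
        (trans (∑-triangle N (λ i j → X j * (X i * has k i j)))
          (∑-cong N (λ i _ → trans (∑-cong N (λ j _ → reorder (𝟙 (i <? j)) (X j) (X i) (has k i j)))
            (∑-*ˡ N (X i) _))))
      where
      reorder : ∀ a b c d → a * (b * (c * d)) ≡ c * (a * (b * d))
      reorder = solve-∀

  skewed-pairs : ∀ cap k (X : ℕ → ℕ) → Bin X →
    (∀ j → j < N → X j ≡ 1 → R k j ≤ cap × L (other k) j ≤ cap) →
    pairs (∑ N X) ≤ 2 * capped (∑ N X) cap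
  skewed-pairs cap k X bX skewed = begin
    pairs (∑ N X)                             ≡⟨ pairs-split k X bX ⟩
    inner k X + inner (other k) X             ≤⟨ +-mono-≤ (inner-forward k cap X bX (λ j j<N Xj≡1 → proj₁ (skewed j j<N Xj≡1)))
                                                           (inner-backward (other k) cap X bX (λ j j<N Xj≡1 → proj₂ (skewed j j<N Xj≡1))) ⟩
    capped (∑ N X) cap + capped (∑ N X) cap   ≡⟨ cong (capped (∑ N X) cap +_) (≡-sym (+-identityʳ _)) ⟩
    2 * capped (∑ N X) cap                    ∎
    where open ≤-Reasoning

  skewed-small : ∀ t k (X : ℕ → ℕ) → Bin X →
    (∀ j → j < N → X j ≡ 1 → R k j ≤ 11 + 12 * t × L (other k) j ≤ 11 + 12 * t) →
    ∑ N X < 41 * suc t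
  skewed-small t k X bX skewed = ≰⇒> λ big →
    <⇒≱ (capped-too-small t (∑ N X) big) (skewed-pairs (11 + 12 * t) k X bX skewed)

select : ∀ n {P : ℕ → Set} → (∀ i → Dec (P i)) → Subset n
select n P? = tabulate (λ v → does (P? (toℕ v)))

∣select∣ : ∀ n {P : ℕ → Set} (P? : ∀ i → Dec (P i)) → ∣ select n P? ∣ ≡ ∑[ i < n ] 𝟙 (P? i)
∣select∣ zero    P? = refl
∣select∣ (suc n) P? rewrite ∑-suc n (λ i → 𝟙 (P? i)) with P? 0
... | yes _ = cong suc (∣select∣ n (λ i → P? (suc i)))
... | no  _ = ∣select∣ n (λ i → P? (suc i))

∈select : ∀ n {P : ℕ → Set} (P? : ∀ i → Dec (P i)) {v : Fin n} → v ∈ select n P? → P (toℕ v)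
∈select n P? {v} v∈ = decided (P? (toℕ v))
  (trans (≡-sym (lookup∘tabulate (λ w → does (P? (toℕ w))) v)) ([]=⇒lookup v∈))
  where
  decided : ∀ {A : Set} (a? : Dec A) → does a? ≡ true → A
  decided (yes a) _ = a

count≤filter : ∀ {A : Set} n (f : Fin n → A) {Q : ℕ → Set} (Q? : ∀ i → Dec (Q i))
  {P : A → Set} (P? : ∀ x → Dec (P x)) → (∀ v → Q (toℕ v) → P (f v)) →
  ∑[ i < n ] 𝟙 (Q? i) ≤ List.length (List.filter P? (List.tabulate f))
count≤filter zero    f Q? P? Q⇒P = z≤n
count≤filter (suc n) f Q? P? Q⇒P = step
  where
  rest : ∑[ i < n ] 𝟙 (Q? (suc i)) ≤ List.length (List.filter P? (List.tabulate (λ v → f (Fin.suc v))))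
  rest = count≤filter n (λ v → f (Fin.suc v)) (λ i → Q? (suc i)) P? (λ v → Q⇒P (Fin.suc v))
  step : ∑[ i < suc n ] 𝟙 (Q? i) ≤ List.length (List.filter P? (List.tabulate f))
  step rewrite ∑-suc n (λ i → 𝟙 (Q? i)) with Q? 0 | P? (f Fin.zero)
  ... | yes _  | yes _  = s≤s rest
  ... | yes q  | no ¬p  = ⊥-elim (¬p (Q⇒P Fin.zero q))
  ... | no  _  | yes _  = m≤n⇒m≤1+n rest
  ... | no  _  | no  _  = rest

half-bound : ∀ {a x y} → a + a ≤ x + y → ¬ a ≤ x → a ≤ y
half-bound {a} {x} {y} 2a≤x+y a≰x with a ≤? y
... | yes a≤y = a≤y
... | no  a≰y = ⊥-elim (<⇒≱ (+-mono-< (≰⇒> a≰x) (≰⇒> a≰y)) 2a≤x+y)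

middle-count : ∀ N A (T : ℕ → ℕ) → A + A ≤ N → (∀ i → A ≤ i → i + A < N → 1 ≤ T i) → N ≤ A + A + ∑ N T
middle-count N A T 2A≤N covered = begin
  N                 ≤⟨ m≤n+m∸n N (A + A) ⟩
  A + A + len       ≤⟨ +-monoʳ-≤ (A + A) len≤∑ ⟩
  A + A + ∑ N T     ∎
  where
  open ≤-Reasoning
  len : ℕ
  len = N ∸ (A + A)
  regroup : ∀ x y → x + y + x ≡ y + (x + x)
  regroup = solve-∀
  A+len+A≡N : A + len + A ≡ N
  A+len+A≡N = trans (regroup A len) (m∸n+n≡m 2A≤N)
  middle : ∀ i → i < len → A + i + A < N
  middle i i<len = <-≤-trans (+-monoˡ-< A (+-monoʳ-< A i<len)) (≤-reflexive A+len+A≡N)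
  len≤∑ : len ≤ ∑ N T
  len≤∑ = begin
    len                               ≡⟨ ≡-sym (trans (∑-const len 1) (*-identityʳ len)) ⟩
    ∑[ i < len ] 1                    ≤⟨ ∑-mono len (λ i i<len → covered (A + i) (m≤m+n A i) (middle i i<len)) ⟩
    ∑[ i < len ] T (A + i)            ≤⟨ m≤n+m _ (∑ A T) ⟩
    ∑ A T + ∑[ i < len ] T (A + i)    ≡⟨ ≡-sym (∑-++ A len T) ⟩
    ∑ (A + len) T                     ≤⟨ ∑-monoˡ T (≤-trans (m≤m+n (A + len) A) (≤-reflexive A+len+A≡N)) ⟩
    ∑ N T                             ∎

four-summands : ∀ {x A B C D} → x ≤ A ⊎ x ≤ B ⊎ x ≤ C ⊎ x ≤ D → x ≤ A + B + C + D
four-summands {x} {A} {B} {C} {D} (inj₁ x≤A) =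
  ≤-trans x≤A (≤-trans (m≤m+n A B) (≤-trans (m≤m+n (A + B) C) (m≤m+n (A + B + C) D)))
four-summands {x} {A} {B} {C} {D} (inj₂ (inj₁ x≤B)) =
  ≤-trans x≤B (≤-trans (m≤n+m B A) (≤-trans (m≤m+n (A + B) C) (m≤m+n (A + B + C) D)))
four-summands {x} {A} {B} {C} {D} (inj₂ (inj₂ (inj₁ x≤C))) =
  ≤-trans x≤C (≤-trans (m≤n+m C (A + B)) (m≤m+n (A + B + C) D))
four-summands {x} {A} {B} {C} {D} (inj₂ (inj₂ (inj₂ x≤D))) =
  ≤-trans x≤D (m≤n+m D (A + B + C))

module Thresholds {N : ℕ} (c : Colouring N) (a : ℕ) where
  open Degrees c

  Rich : Colour → ℕ → Set
  Rich k u = u < N × a ≤ L k u × a ≤ R k u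

  rich? : ∀ k u → Dec (Rich k u)
  rich? k u = (u <? N) ×-dec (a ≤? L k u) ×-dec (a ≤? R k u)

  Skewed : Colour → ℕ → Set
  Skewed k u = R k u < a × L (other k) u < a

  skewed? : ∀ k u → Dec (Skewed k u)
  skewed? k u = (R k u <? a) ×-dec (L (other k) u <? a)

  -- With 2a vertices on a side, one of the two colours reaches a there.
  red-left : ∀ {u} → a + a ≤ u → ¬ a ≤ L blue u → a ≤ L red u
  red-left {u} far = half-bound (≤-trans far (≤-reflexive (≡-sym (L-total blue u))))

  red-right : ∀ {u} → a + a ≤ N ∸ suc u → ¬ a ≤ R blue u → a ≤ R red u
  red-right {u} far = half-bound (≤-trans far (≤-reflexive (≡-sym (R-total blue u))))

  classify : ∀ u → u < N → a + a ≤ u → a + a ≤ N ∸ suc u →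
    Rich blue u ⊎ Rich red u ⊎ Skewed blue u ⊎ Skewed red u
  classify u u<N far-left far-right with a ≤? R blue u
  ... | yes aRb with a ≤? L blue u
  ...   | yes aLb = inj₁ (u<N , aLb , aRb)
  ...   | no  aLb with a ≤? R red u
  ...     | yes aRr = inj₂ (inj₁ (u<N , red-left far-left aLb , aRr))
  ...     | no  aRr = inj₂ (inj₂ (inj₂ (≰⇒> aRr , ≰⇒> aLb)))
  classify u u<N far-left far-right | no aRb with a ≤? L red u
  ...   | yes aLr = inj₂ (inj₁ (u<N , aLr , red-right far-right aRb))
  ...   | no  aLr = inj₂ (inj₂ (inj₁ (≰⇒> aRb , ≰⇒> aLr)))

  weight : ℕ → ℕ
  weight u = 𝟙 (rich? blue u) + 𝟙 (rich? red u) + 𝟙 (skewed? blue u) + 𝟙 (skewed? red u)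

  weight-pos : ∀ u → Rich blue u ⊎ Rich red u ⊎ Skewed blue u ⊎ Skewed red u → 1 ≤ weight u
  weight-pos u = four-summands ∘ map (𝟙-pos (rich? blue u))
    (map (𝟙-pos (rich? red u)) (map (𝟙-pos (skewed? blue u)) (𝟙-pos (skewed? red u))))

  #rich : Colour → ℕ
  #rich k = ∑[ u < N ] 𝟙 (rich? k u)

  #skewed : Colour → ℕ
  #skewed k = ∑[ u < N ] 𝟙 (skewed? k u)

  weight-sum : ∑ N weight ≡ #rich blue + #rich red + #skewed blue + #skewed red
  weight-sum =
    trans (∑-+ N (λ u → 𝟙 (rich? blue u) + 𝟙 (rich? red u) + 𝟙 (skewed? blue u)) (λ u → 𝟙 (skewed? red u)))
      (cong (_+ #skewed red)
        (trans (∑-+ N (λ u → 𝟙 (rich? blue u) + 𝟙 (rich? red u)) (λ u → 𝟙 (skewed? blue u)))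
          (cong (_+ #skewed blue) (∑-+ N (λ u → 𝟙 (rich? blue u)) (λ u → 𝟙 (rich? red u))))))

  rich-or-skewed : (a + a) + (a + a) ≤ N →
    N ≤ (a + a) + (a + a) + (#rich blue + #rich red + #skewed blue + #skewed red)
  rich-or-skewed 4a≤N = ≤-trans (middle-count N (a + a) weight 4a≤N covered)
    (≤-reflexive (cong ((a + a) + (a + a) +_) weight-sum))
    where
    covered : ∀ u → a + a ≤ u → u + (a + a) < N → 1 ≤ weight u
    covered u far-left u+2a<N = weight-pos u (classify u (m+n≤o⇒m≤o (suc u) u+2a<N) far-left
      (m+n≤o⇒m≤o∸n (a + a) (≤-trans (≤-reflexive (+-comm (a + a) (suc u))) u+2a<N)))

window-margin : ∀ {d s a y x} → d + s < a → a ≤ y + x → x < s → d < y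
window-margin {d} {s} {a} {y} {x} d+s<a a≤y+x x<s =
  +-cancelʳ-< s d y (<-≤-trans d+s<a (≤-trans a≤y+x (+-monoʳ-≤ y (<⇒≤ x<s))))

offset-left : ∀ {p s u} → p ≤ u → u < p + s → u ∸ p < s
offset-left {p} {s} {u} p≤u u<p+s = +-cancelˡ-< p (u ∸ p) s (subst (_< p + s) (≡-sym (m+[n∸m]≡n p≤u)) u<p+s)

offset-right : ∀ {p s u} → p ≤ u → u < p + s → p + s ∸ suc u < s
offset-right {p} {s} {u} p≤u u<p+s = +-cancelʳ-< (suc u) (p + s ∸ suc u) s (begin-strict
  p + s ∸ suc u + suc u   ≡⟨ m∸n+n≡m u<p+s ⟩
  p + s                   ≤⟨ +-monoˡ-≤ s p≤u ⟩
  u + s                   ≡⟨ +-comm u s ⟩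
  s + u                   <⟨ +-monoʳ-< s (n<1+n u) ⟩
  s + suc u               ∎)
  where open ≤-Reasoning

module RichBlock {N : ℕ} (c : Colouring N) (a : ℕ) (k : Colour) (p s : ℕ) where
  open Degrees c
  open Thresholds c a

  InBlock : ℕ → Set
  InBlock i = p ≤ i × i < p + s × Rich k i

  inBlock? : ∀ i → Dec (InBlock i)
  inBlock? i = (p ≤? i) ×-dec (i <? p + s) ×-dec rich? k i

  U : Subset N
  U = select N inBlock?

  U-size : ∑[ i < s ] 𝟙 (rich? k (p + i)) ≤ ∣ U ∣
  U-size = begin
    ∑[ i < s ] 𝟙 (rich? k (p + i))
      ≤⟨ ∑-mono s (λ i i<s → 𝟙-mono (rich? k (p + i)) (inBlock? (p + i)) (λ r → m≤m+n p i , +-monoʳ-< p i<s , r)) ⟩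
    ∑[ i < s ] 𝟙 (inBlock? (p + i))
      ≤⟨ m≤n+m _ _ ⟩
    ∑[ i < p ] 𝟙 (inBlock? i) + ∑[ i < s ] 𝟙 (inBlock? (p + i))
      ≡⟨ ≡-sym (∑-++ p s _) ⟩
    ∑[ i < p + s ] 𝟙 (inBlock? i)
      ≤⟨ ∑-support (p + s) N _ (λ i N≤i → 𝟙-no (inBlock? i) (λ (_ , _ , i<N , _) → ≤⇒≯ N≤i i<N)) ⟩
    ∑[ i < N ] 𝟙 (inBlock? i)
      ≡⟨ ≡-sym (∣select∣ N inBlock?) ⟩
    ∣ U ∣
      ∎
    where open ≤-Reasoning

  U-in-block : ∀ {u} → u ∈ U → InBlock (toℕ u)
  U-in-block = ∈select N inBlock?

  -- Colour-k neighbours before p are to the left of U.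
  left-count : ∀ {u} → u ∈ U → ∑[ v < p ] has k (toℕ u) v ≤ leftNbrs c k U u
  left-count {u} u∈U = begin
    ∑[ v < p ] has k (toℕ u) v                                ≡⟨ ≡-sym (∑-prefix (has k (toℕ u)) p≤N) ⟩
    ∑[ v < N ] (𝟙 (v <? p) * has k (toℕ u) v)                 ≡⟨ ∑-cong N (λ v _ → ≡-sym (𝟙-× (v <? p) (colour (toℕ u) v ≟ᶜ k))) ⟩
    ∑[ v < N ] 𝟙 ((v <? p) ×-dec (colour (toℕ u) v ≟ᶜ k))     ≤⟨ count≤filter N (λ v → v) _ _ left-neighbour ⟩
    leftNbrs c k U u                                          ∎
    where
    open ≤-Reasoning
    p≤N : p ≤ N
    p≤N = ≤-trans (proj₁ (U-in-block u∈U)) (<⇒≤ (toℕ<n u))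
    left-neighbour : ∀ v → toℕ v < p × colour (toℕ u) (toℕ v) ≡ k → col c u v ≡ k × LeftOf U v
    left-neighbour v (v<p , uv≡k) =
      trans (≡-sym (colour-toℕ u v)) uv≡k , λ w w∈U → <-≤-trans v<p (proj₁ (U-in-block w∈U))

  -- Colour-k neighbours from p + s on are to the right of U.
  right-count : ∀ {u} → u ∈ U → ∑[ v < N ] (𝟙 (p + s ≤? v) * has k (toℕ u) v) ≤ rightNbrs c k U u
  right-count {u} u∈U = begin
    ∑[ v < N ] (𝟙 (p + s ≤? v) * has k (toℕ u) v)               ≡⟨ ∑-cong N (λ v _ → ≡-sym (𝟙-× (p + s ≤? v) (colour (toℕ u) v ≟ᶜ k))) ⟩
    ∑[ v < N ] 𝟙 ((p + s ≤? v) ×-dec (colour (toℕ u) v ≟ᶜ k))   ≤⟨ count≤filter N (λ v → v) _ _ right-neighbour ⟩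
    rightNbrs c k U u                                           ∎
    where
    open ≤-Reasoning
    right-neighbour : ∀ v → p + s ≤ toℕ v × colour (toℕ u) (toℕ v) ≡ k → col c u v ≡ k × RightOf U v
    right-neighbour v (e≤v , uv≡k) =
      trans (≡-sym (colour-toℕ u v)) uv≡k , λ w w∈U → <-≤-trans (proj₁ (proj₂ (U-in-block w∈U))) e≤v

  module _ (d : ℕ) (margin : d + s < a) where

    left-margin : ∀ {u} → InBlock u → d < ∑[ v < p ] has k u v
    left-margin {u} (p≤u , u<p+s , _ , a≤L , _) =
      window-margin margin (≤-trans a≤L (L-before k u p p≤u)) (offset-left p≤u u<p+s)

    right-margin : ∀ {u} → InBlock u → d < ∑[ v < N ] (𝟙 (p + s ≤? v) * has k u v)
    right-margin {u} (p≤u , u<p+s , _ , _ , a≤R) =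
      window-margin margin (≤-trans a≤R (R-after k u (p + s))) (offset-right p≤u u<p+s)

    U-left : ∀ {u} → u ∈ U → d < leftNbrs c k U u
    U-left u∈U = <-≤-trans (left-margin (U-in-block u∈U)) (left-count u∈U)

    U-right : ∀ {u} → u ∈ U → d < rightNbrs c k U u
    U-right u∈U = <-≤-trans (right-margin (U-in-block u∈U)) (right-count u∈U)

below-next-multiple : ∀ m n .{{_ : NonZero n}} → m < n + m / n * n
below-next-multiple m n = begin-strict
  m                  ≡⟨ m≡m%n+[m/n]*n m n ⟩
  m % n + m / n * n  <⟨ +-monoˡ-< (m / n * n) (m%n<n m n) ⟩
  n + m / n * n      ∎
  where open ≤-Reasoning

-- With 11d ≤ N, 1000s′ ≤ N and 12T ≤ d + s′ + 13 we have
-- 130T ≤ (130/12)(N/11 + N/1000 + 13), which leaves room for 2000·N/(16·10^5).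
-- Large literals only appear as right factors of products whose left factor is
-- a variable, which keeps the type checker from unfolding them into unary form.
edge-budget : ∀ N d s′ T → d * 11 ≤ N → s′ * 1000 ≤ N → T * 12 ≤ d + suc s′ + 12 →
  130 * T * 132000 ≤ N * 131430 + 18590000
edge-budget N d s′ T d≤ s′≤ T≤ = begin
  130 * T * 132000                                  ≡⟨ cong (_* 132000) (*-comm 130 T) ⟩
  T * 130 * 132000                                  ≡⟨ *-assoc T 130 132000 ⟩
  T * 17160000                                      ≡⟨ ≡-sym (*-assoc T 12 1430000) ⟩
  T * 12 * 1430000                                  ≤⟨ *-monoˡ-≤ 1430000 T≤ ⟩
  (d + suc s′ + 12) * 1430000                       ≡⟨ spread d s′ 1430000 ⟩
  d * 1430000 + s′ * 1430000 + 13 * 1430000         ≡⟨ cong₂ (λ x y → x + y + 18590000)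
                                                         (≡-sym (*-assoc d 11 130000)) (≡-sym (*-assoc s′ 1000 1430)) ⟩
  d * 11 * 130000 + s′ * 1000 * 1430 + 18590000     ≤⟨ +-monoˡ-≤ 18590000 (+-mono-≤ (*-monoˡ-≤ 130000 d≤) (*-monoˡ-≤ 1430 s′≤)) ⟩
  N * 130000 + N * 1430 + 18590000                  ≡⟨ cong (_+ 18590000) (≡-sym (*-distribˡ-+ N 130000 1430)) ⟩
  N * 131430 + 18590000                             ∎
  where
  open ≤-Reasoning
  spread : ∀ d s′ K → (d + suc s′ + 12) * K ≡ d * K + s′ * K + 13 * K
  spread = solve-∀

budget-arith : ∀ N q d s′ T → q * 1600000 ≤ N → d * 11 ≤ N → s′ * 1000 ≤ N →
  T * 12 ≤ d + suc s′ + 12 → 1600000 ≤ N → q * 2000 + 130 * T ≤ N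
budget-arith N q d s′ T q≤ d≤ s′≤ T≤ large = *-cancelʳ-≤ (q * 2000 + 130 * T) N 132000 (begin
  (q * 2000 + 130 * T) * 132000                     ≡⟨ *-distribʳ-+ 132000 (q * 2000) (130 * T) ⟩
  q * 2000 * 132000 + 130 * T * 132000              ≡⟨ cong (_+ 130 * T * 132000)
                                                         (trans (*-assoc q 2000 132000) (≡-sym (*-assoc q 1600000 165))) ⟩
  q * 1600000 * 165 + 130 * T * 132000              ≤⟨ +-mono-≤ (*-monoˡ-≤ 165 q≤) (edge-budget N d s′ T d≤ s′≤ T≤) ⟩
  N * 165 + (N * 131430 + 18590000)                 ≤⟨ +-monoʳ-≤ (N * 165) (+-monoʳ-≤ (N * 131430) constant≤) ⟩
  N * 165 + (N * 131430 + N * 405)                  ≡⟨ cong (N * 165 +_) (≡-sym (*-distribˡ-+ N 131430 405)) ⟩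
  N * 165 + N * 131835                              ≡⟨ ≡-sym (*-distribˡ-+ N 165 131835) ⟩
  N * 132000                                        ∎)
  where
  open ≤-Reasoning
  constant≤ : 18590000 ≤ N * 405
  constant≤ = ≤-trans (≤ᵇ⇒≤ 18590000 (1600000 * 405) tt) (*-monoˡ-≤ 405 large)

-- What remains for the rich vertices once 4a = 48(t + 1) end vertices and two
-- skewed sets of fewer than 41(t + 1) vertices are removed.
rich-leftover : ∀ N G X Y q t → q * 2000 + 130 * suc t ≤ N → N ≤ 48 * suc t + (G + X + Y) →
  X < 41 * suc t → Y < 41 * suc t → q * 2000 ≤ G
rich-leftover N G X Y q t budget cover X< Y< = +-cancelʳ-≤ (130 * suc t) (q * 2000) G (begin
  q * 2000 + 130 * suc t                          ≤⟨ budget ⟩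
  N                                               ≤⟨ cover ⟩
  48 * suc t + (G + X + Y)                        ≤⟨ +-monoʳ-≤ (48 * suc t) (+-mono-≤ (+-monoʳ-≤ G (<⇒≤ X<)) (<⇒≤ Y<)) ⟩
  48 * suc t + (G + 41 * suc t + 41 * suc t)      ≡⟨ regroup G t ⟩
  G + 130 * suc t                                 ∎)
  where
  open ≤-Reasoning
  regroup : ∀ G t → 48 * suc t + (G + 41 * suc t + 41 * suc t) ≡ G + 130 * suc t
  regroup = solve-∀

scale-eleven : ∀ {N d y} → N < 11 + d * 11 → d < y → N ≤ 11 * y
scale-eleven {N} {d} {y} N< d<y =
  <⇒≤ (<-≤-trans N< (≤-trans (≤-reflexive (*-comm (suc d) 11)) (*-monoʳ-≤ 11 d<y)))

module LargeCase (N : ℕ) (c : Colouring N) (large : 1600000 ≤ N) where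

  q d s t a : ℕ
  q = N / 1600000
  d = N / 11
  s = suc (N / 1000)
  t = (d + s) / 12
  a = suc (11 + 12 * t)

  open Degrees c
  open Thresholds c a

  margin : d + s < a
  margin = ≤-trans (below-next-multiple (d + s) 12) (≤-reflexive (cong (12 +_) (*-comm t 12)))

  N<11+11d : N < 11 + d * 11
  N<11+11d = below-next-multiple N 11

  N≤1000s : N ≤ s * 1000
  N≤1000s = <⇒≤ (below-next-multiple N 1000)

  budget : q * 2000 + 130 * suc t ≤ N
  budget = budget-arith N q d (N / 1000) (suc t)
    (m/n*n≤m N 1600000) (m/n*n≤m N 11) (m/n*n≤m N 1000)
    (≤-trans (≤-reflexive (+-comm 12 (t * 12))) (+-monoˡ-≤ 12 (m/n*n≤m (d + s) 12))) large

  four-a : (a + a) + (a + a) ≡ 48 * suc t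
  four-a = expand t
    where
    expand : ∀ t → suc (11 + 12 * t) + suc (11 + 12 * t) + (suc (11 + 12 * t) + suc (11 + 12 * t)) ≡ 48 * suc t
    expand = solve-∀

  skewed-few : ∀ k → #skewed k < 41 * suc t
  skewed-few k = skewed-small t k (λ u → 𝟙 (skewed? k u)) (λ u → 𝟙≤1 (skewed? k u))
    (λ u _ is-skewed → let (R<a , L<a) = 𝟙⇒ (skewed? k u) is-skewed in ≤-pred R<a , ≤-pred L<a)

  rich-total : q * 1000 + q * 1000 ≤ #rich blue + #rich red
  rich-total = ≤-trans (≤-reflexive (≡-sym (*-distribˡ-+ q 1000 1000)))
    (rich-leftover N (#rich blue + #rich red) (#skewed blue) (#skewed red) q t budget
      (subst (λ m → N ≤ m + (#rich blue + #rich red + #skewed blue + #skewed red)) four-a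
        (rich-or-skewed (subst (_≤ N) (≡-sym four-a) 48st≤N)))
      (skewed-few blue) (skewed-few red))
    where
    48st≤N : 48 * suc t ≤ N
    48st≤N = ≤-trans (*-monoˡ-≤ (suc t) (≤ᵇ⇒≤ 48 130 tt)) (m+n≤o⇒n≤o (q * 2000) budget)

  colour-choice : ∃ λ k → q * 1000 ≤ #rich k
  colour-choice with q * 1000 ≤? #rich blue
  ... | yes many = blue , many
  ... | no  few  = red , half-bound rich-total few

  dense-block : ∀ k → q * 1000 ≤ #rich k → ∃ λ j → q ≤ ∑[ i < s ] 𝟙 (rich? k (s * j + i))
  dense-block k many = pigeonhole 999 q (λ j → ∑[ i < s ] 𝟙 (rich? k (s * j + i))) (begin
    1000 * q                                         ≡⟨ *-comm 1000 q ⟩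
    q * 1000                                         ≤⟨ many ⟩
    #rich k                                          ≤⟨ ∑-monoˡ (λ u → 𝟙 (rich? k u)) N≤1000s ⟩
    ∑[ u < s * 1000 ] 𝟙 (rich? k u)                  ≡⟨ ∑-blocks s 1000 (λ u → 𝟙 (rich? k u)) ⟩
    ∑[ j < 1000 ] ∑[ i < s ] 𝟙 (rich? k (s * j + i)) ∎)
    where open ≤-Reasoning

  block-set : ∀ k j → q ≤ ∑[ i < s ] 𝟙 (rich? k (s * j + i)) →
    Σ (Subset N) (λ U → (q ≤ ∣ U ∣) × Good c k U)
  block-set k j dense = U , ≤-trans dense U-size ,
    λ u u∈U → scale-eleven N<11+11d (U-left d margin u∈U) , scale-eleven N<11+11d (U-right d margin u∈U)
    where open RichBlock c a k (s * j) s

  either-colour : ∀ k → Σ (Subset N) (λ U → (q ≤ ∣ U ∣) × Good c k U) →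
    Σ (Subset N) (λ U → (q ≤ ∣ U ∣) × (Good c blue U ⊎ Good c red U))
  either-colour blue (U , size , good) = U , size , inj₁ good
  either-colour red  (U , size , good) = U , size , inj₂ good

  homogeneous-set : Σ (Subset N) (λ U → (q ≤ ∣ U ∣) × (Good c blue U ⊎ Good c red U))
  homogeneous-set = either-colour k (block-set k j (proj₂ (dense-block k (proj₂ colour-choice))))
    where
    k : Colour
    k = proj₁ colour-choice
    j : ℕ
    j = proj₁ (dense-block k (proj₂ colour-choice))

-- For N < 16·10^5 the bound is 0 and the empty set is vacuously good.
lemma3 : (N : ℕ) (c : Colouring N) →
    Σ (Subset N) (λ U → (N / 1600000 ≤ ∣ U ∣) × (Good c blue U ⊎ Good c red U))
lemma3 N c with N <? 1600000
... | yes small = ∅ , ≤-trans (≤-reflexive (m<n⇒m/n≡0 small)) z≤n , inj₁ (λ u u∈∅ → ⊥-elim (∉⊥ u∈∅))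
... | no  large = LargeCase.homogeneous-set N c (≮⇒≥ large)
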